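{- Let $k$ be a positive integer and $G$ a graph. Let $\mathcal{H}$ be the hypergraph with vertex set $V(G)$ whose hyperedges are exactly the minimal clique transversals $X$ of $G$ with $|X|\le k$. Then the following are equivalent: (1) $\tau_c^+(G)\le k$; (2) $\mathcal{H}$ is the hypergraph of all minimal clique transversals of $G$; (3) the dual hypergraph $\mathcal{H}^d$ is conformal and $G=G(\mathcal{H}^d)$.
   Context: Graphs are finite, simple, undirected, with nonempty vertex set. A clique transversal of $G$ is a set of vertices intersecting every maximal clique; minimal if no proper subset is one; $\tau_c^+(G)$ is the maximum size of a minimal clique transversal. For a hypergraph (a finite vertex set with a family of subsets called hyperedges), a transversal is a vertex set meeting every hyperedge, minimal if no proper subset is a transversal; the dual $\mathcal{H}^d$ has the same vertex set and hyperedges the minimal transversals of $\mathcal{H}$. The co-occurrence graph $G(\cdot)$ of a hypergraph has the same vertex set, with distinct vertices adjacent iff some hyperedge contains both. A hypergraph is conformal if for every vertex set $U$ whose every pair lies in a common hyperedge, $U$ is contained in some hyperedge. -}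

module Defs where

open import Data.Nat using (ℕ; suc; _≤_)
open import Data.Fin using (Fin)
open import Data.Fin.Subset using (Subset; _∈_; _⊆_; ∣_∣)
open import Data.Product using (Σ; _×_; ∃)
open import Relation.Binary.PropositionalEquality using (_≡_; _≢_)
open import Relation.Nullary using (¬_; Dec)
open import Function.Bundles using (_⇔_)

record Graph : Set₁ where
  field
    n      : ℕ
    Adj    : Fin (suc n) → Fin (suc n) → Set
    adj?   : ∀ u v → Dec (Adj u v)
    sym    : ∀ {u v} → Adj u v → Adj v u
    irrefl : ∀ {u} → ¬ Adj u u

open Graph public

V : Graph → Set
V G = Fin (suc (n G))

VSet : Graph → Set
VSet G = Subset (suc (n G))

IsClique : (G : Graph) → VSet G → Set
IsClique G C = ∀ u v → u ∈ C → v ∈ C → u ≢ v → Adj G u v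

IsMaximalClique : (G : Graph) → VSet G → Set
IsMaximalClique G C = IsClique G C × (∀ D → IsClique G D → C ⊆ D → D ⊆ C)

IsCliqueTransversal : (G : Graph) → VSet G → Set
IsCliqueTransversal G X =
  ∀ C → IsMaximalClique G C → ∃ λ v → v ∈ X × v ∈ C

IsMinCliqueTransversal : (G : Graph) → VSet G → Set
IsMinCliqueTransversal G X =
  IsCliqueTransversal G X × (∀ Y → Y ⊆ X → IsCliqueTransversal G Y → X ⊆ Y)

-- τ_c^+(G) ≤ k : the maximum size of a minimal clique transversal is at most k,
-- i.e. every minimal clique transversal has size at most k
τc⁺≤ : Graph → ℕ → Set
τc⁺≤ G k = ∀ X → IsMinCliqueTransversal G X → ∣ X ∣ ≤ k

record Hypergraph (m : ℕ) : Set₁ where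
  field
    Edge : Subset m → Set

open Hypergraph public

IsTransversal : ∀ {m} → Hypergraph m → Subset m → Set
IsTransversal H T = ∀ E → Edge H E → ∃ λ v → v ∈ T × v ∈ E

IsMinTransversal : ∀ {m} → Hypergraph m → Subset m → Set
IsMinTransversal H T =
  IsTransversal H T × (∀ Y → Y ⊆ T → IsTransversal H Y → T ⊆ Y)

dual : ∀ {m} → Hypergraph m → Hypergraph m
dual H = record { Edge = IsMinTransversal H }

_≅H_ : ∀ {m} → Hypergraph m → Hypergraph m → Set
H ≅H K = ∀ E → Edge H E ⇔ Edge K E

CoOcc : ∀ {m} → Hypergraph m → Fin m → Fin m → Set
CoOcc H u v = u ≢ v × (∃ λ E → Edge H E × u ∈ E × v ∈ E)

IsConformal : ∀ {m} → Hypergraph m → Set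
IsConformal H =
  ∀ U → (∀ u v → u ∈ U → v ∈ U → u ≢ v → ∃ λ E → Edge H E × u ∈ E × v ∈ E)
      → ∃ λ E → Edge H E × U ⊆ E

IsCoOccGraphOf : (G : Graph) → Hypergraph (suc (n G)) → Set
IsCoOccGraphOf G H = ∀ u v → Adj G u v ⇔ CoOcc H u v

minCTHypergraph : (G : Graph) → Hypergraph (suc (n G))
minCTHypergraph G = record { Edge = IsMinCliqueTransversal G }

smallMinCTHypergraph : (G : Graph) → ℕ → Hypergraph (suc (n G))
smallMinCTHypergraph G k =
  record { Edge = λ X → IsMinCliqueTransversal G X × ∣ X ∣ ≤ k }

{-# OPTIONS --safe #-}
-- The maximal cliques of G form a Sperner hypergraph 𝒞 whose dual is the
-- hypergraph of minimal clique transversals. Dualization is an involution on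
-- Sperner hypergraphs, and H is Sperner (its edges are among those of a dual),
-- so (2) holds iff the dual of H is 𝒞. A Sperner hypergraph K is conformal
-- with G = G(K) iff K is 𝒞: co-occurrence makes every edge of K a clique, and
-- conformality puts every clique of G inside an edge of K. Applied to the
-- Sperner hypergraph K = dual H, this says that (3) is the same condition.
module Submission where

open import Defs
open import Level using (Level)
open import Data.Nat using (ℕ; suc; _≤_)
open import Data.Nat.Properties using (_≤?_)
open import Data.Product using (_×_; _,_; proj₁; proj₂; ∃)
open import Data.Sum using (_⊎_; inj₁; inj₂)
import Data.Sum as Sum
open import Data.Fin using (Fin; _≟_)
open import Data.Fin.Properties using (any?; all?)
open import Data.Fin.Subset using (Subset; _∈_; _∉_; _⊆_; _⊂_; _⊃_; ∁; _∪_; ⁅_⁆; ∣_∣)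
open import Data.Fin.Subset.Properties
  using (_∈?_; _⊆?_; _⊂?_; anySubset?; ⊆-refl; ⊆-trans; ⊆-antisym; x∉p⇒x∈∁p; x∈∁p⇒x∉p;
         x∈p∪q⁻; x∈p∪q⁺; x∈⁅x⁆; x∈⁅y⁆⇒x≡y)
open import Data.Fin.Subset.Induction using (Acc; acc; ⊂-wellFounded; ⊃-wellFounded)
open import Relation.Unary using (Pred; Decidable)
open import Relation.Nullary using (¬_; Dec; yes; no; contradiction)
open import Relation.Nullary.Decidable using (_×-dec_; _→-dec_; ¬?; decidable-stable)
open import Relation.Binary.PropositionalEquality using (_≡_; _≢_; refl; subst)
open import Function.Bundles using (_⇔_; mk⇔; Equivalence)
import Function.Properties.Equivalence as ⇔
open Equivalence using (to; from)

private
  variable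
    ℓ : Level
    m : ℕ

allSubset? : {P : Pred (Subset m) ℓ} → Decidable P → Dec (∀ S → P S)
allSubset? P? with anySubset? (λ S → ¬? (P? S))
... | yes (S , ¬PS) = no λ ∀P → ¬PS (∀P S)
... | no ∄¬P        = yes λ S → decidable-stable (P? S) (λ ¬PS → ∄¬P (S , ¬PS))

⊈⇒∃∉ : {p q : Subset m} → ¬ (p ⊆ q) → ∃ λ x → x ∈ p × x ∉ q
⊈⇒∃∉ {p = p} {q} p⊈q with any? (λ x → x ∈? p ×-dec ¬? (x ∈? q))
... | yes witness = witness
... | no ∄x       = contradiction
  (λ {x} x∈p → decidable-stable (x ∈? q) (λ x∉q → ∄x (x , x∈p , x∉q))) p⊈q

⊆∧⊄⇒⊇ : {p q : Subset m} → p ⊆ q → ¬ (p ⊂ q) → q ⊆ p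
⊆∧⊄⇒⊇ {p = p} {q} p⊆q p⊄q = decidable-stable (q ⊆? p) λ q⊈p →
  let (x , x∈q , x∉p) = ⊈⇒∃∉ q⊈p in p⊄q (p⊆q , x , x∈q , x∉p)

∈-pair : {x u v : Fin m} → x ∈ ⁅ u ⁆ ∪ ⁅ v ⁆ → x ≡ u ⊎ x ≡ v
∈-pair {u = u} {v} x∈ = Sum.map (x∈⁅y⁆⇒x≡y u) (x∈⁅y⁆⇒x≡y v) (x∈p∪q⁻ ⁅ u ⁆ ⁅ v ⁆ x∈)

-- The argument orders make IsMinTransversal H and IsMaximalClique G
-- definitionally Minimal (IsTransversal H) and Maximal (IsClique G).
Minimal : Pred (Subset m) ℓ → Pred (Subset m) ℓ
Minimal P X = P X × (∀ Y → Y ⊆ X → P Y → X ⊆ Y)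

Maximal : Pred (Subset m) ℓ → Pred (Subset m) ℓ
Maximal P X = P X × (∀ Y → P Y → X ⊆ Y → Y ⊆ X)

minimal? : {P : Pred (Subset m) ℓ} → Decidable P → Decidable (Minimal P)
minimal? P? X = P? X ×-dec allSubset? (λ Y → Y ⊆? X →-dec P? Y →-dec X ⊆? Y)

maximal? : {P : Pred (Subset m) ℓ} → Decidable P → Decidable (Maximal P)
maximal? P? X = P? X ×-dec allSubset? (λ Y → P? Y →-dec X ⊆? Y →-dec Y ⊆? X)

module _ {P : Pred (Subset m) ℓ} (P? : Decidable P) where

  minimal-⊆ : ∀ X → P X → ∃ λ Y → Y ⊆ X × Minimal P Y
  minimal-⊆ X = go X (⊂-wellFounded X)
    where
    go : ∀ X → Acc _⊂_ X → P X → ∃ λ Y → Y ⊆ X × Minimal P Y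
    go X (acc smaller) PX with anySubset? (λ Z → Z ⊂? X ×-dec P? Z)
    ... | yes (Z , Z⊂X , PZ) =
      let (Y , Y⊆Z , minY) = go Z (smaller Z⊂X) PZ in Y , ⊆-trans Y⊆Z (proj₁ Z⊂X) , minY
    ... | no ∄Z = X , ⊆-refl , PX , λ Z Z⊆X PZ → ⊆∧⊄⇒⊇ Z⊆X (λ Z⊂X → ∄Z (Z , Z⊂X , PZ))

  maximal-⊇ : ∀ X → P X → ∃ λ Y → X ⊆ Y × Maximal P Y
  maximal-⊇ X = go X (⊃-wellFounded X)
    where
    go : ∀ X → Acc _⊃_ X → P X → ∃ λ Y → X ⊆ Y × Maximal P Y
    go X (acc larger) PX with anySubset? (λ Z → X ⊂? Z ×-dec P? Z)
    ... | yes (Z , X⊂Z , PZ) =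
      let (Y , Z⊆Y , maxY) = go Z (larger X⊂Z) PZ in Y , ⊆-trans (proj₁ X⊂Z) Z⊆Y , maxY
    ... | no ∄Z = X , ⊆-refl , PX , λ Z PZ X⊆Z → ⊆∧⊄⇒⊇ X⊆Z (λ X⊂Z → ∄Z (Z , X⊂Z , PZ))

≅H-sym : {H K : Hypergraph m} → H ≅H K → K ≅H H
≅H-sym H≅K E = ⇔.sym (H≅K E)

≅H-trans : {H K L : Hypergraph m} → H ≅H K → K ≅H L → H ≅H L
≅H-trans H≅K K≅L E = ⇔.trans (H≅K E) (K≅L E)

IsSperner : Hypergraph m → Set
IsSperner H = ∀ {D E} → Edge H D → Edge H E → D ⊆ E → E ⊆ D

transversal? : (H : Hypergraph m) → Decidable (Edge H) → Decidable (IsTransversal H)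
transversal? H edge? T = allSubset? λ E → edge? E →-dec any? (λ v → v ∈? T ×-dec v ∈? E)

dual-edge? : (H : Hypergraph m) → Decidable (Edge H) → Decidable (Edge (dual H))
dual-edge? H edge? = minimal? (transversal? H edge?)

dual-sperner : (H : Hypergraph m) → IsSperner (dual H)
dual-sperner H minD minE D⊆E = proj₂ minE _ D⊆E (proj₁ minD)

transversal-resp-≅H : {H K : Hypergraph m} {T : Subset m} →
                      H ≅H K → IsTransversal H T → IsTransversal K T
transversal-resp-≅H H≅K transT E edgeE = transT E (from (H≅K E) edgeE)

minTransversal-resp-≅H : {H K : Hypergraph m} {T : Subset m} →
                         H ≅H K → IsMinTransversal H T → IsMinTransversal K T
minTransversal-resp-≅H H≅K (transT , minT) =
  transversal-resp-≅H H≅K transT ,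
  λ Y Y⊆T transY → minT Y Y⊆T (transversal-resp-≅H (≅H-sym H≅K) transY)

dual-resp-≅H : {H K : Hypergraph m} → H ≅H K → dual H ≅H dual K
dual-resp-≅H H≅K T = mk⇔ (minTransversal-resp-≅H H≅K) (minTransversal-resp-≅H (≅H-sym H≅K))

∁-transversal : (H : Hypergraph m) {X : Subset m} →
                ¬ (∃ λ E → Edge H E × E ⊆ X) → IsTransversal H (∁ X)
∁-transversal H {X} ∄E⊆X E edgeE with E ⊆? X
... | yes E⊆X = contradiction (E , edgeE , λ {x} → E⊆X {x}) ∄E⊆X
... | no E⊈X  = let (w , w∈E , w∉X) = ⊈⇒∃∉ E⊈X in w , x∉p⇒x∈∁p w∉X , w∈E

edge-transversal-dual : (H : Hypergraph m) {C : Subset m} →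
                        Edge H C → IsTransversal (dual H) C
edge-transversal-dual H edgeC T (transT , _) =
  let (v , v∈T , v∈C) = transT _ edgeC in v , v∈C , v∈T

-- By the Sperner property the only edge inside C is C itself, which contains v.
sperner-∁-∪-⁅⁆-transversal : (H : Hypergraph m) → IsSperner H → {C : Subset m} {v : Fin m} →
                             Edge H C → v ∈ C → IsTransversal H (∁ C ∪ ⁅ v ⁆)
sperner-∁-∪-⁅⁆-transversal H sperner {C} {v} edgeC v∈C D edgeD with D ⊆? C
... | yes D⊆C = v , x∈p∪q⁺ (inj₂ (x∈⁅x⁆ v)) , sperner edgeD edgeC D⊆C v∈C
... | no D⊈C  = let (w , w∈D , w∉C) = ⊈⇒∃∉ D⊈C in w , x∈p∪q⁺ (inj₁ (x∉p⇒x∈∁p w∉C)) , w∈D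

module _ (H : Hypergraph m) (edge? : Decidable (Edge H)) (sperner : IsSperner H) where

  sperner-edge⇒minTransversal-dual : ∀ {C} → Edge H C → IsMinTransversal (dual H) C
  sperner-edge⇒minTransversal-dual {C} edgeC = edge-transversal-dual H edgeC , C⊆
    where
    C⊆ : ∀ Y → Y ⊆ C → IsTransversal (dual H) Y → C ⊆ Y
    C⊆ Y Y⊆C transY {v} v∈C with v ∈? Y
    ... | yes v∈Y = v∈Y
    ... | no v∉Y with minimal-⊆ (transversal? H edge?) (∁ C ∪ ⁅ v ⁆)
                      (sperner-∁-∪-⁅⁆-transversal H sperner edgeC v∈C)
    ... | X , X⊆ , minX with transY X minX
    ... | w , w∈Y , w∈X with x∈p∪q⁻ (∁ C) ⁅ v ⁆ (X⊆ w∈X)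
    ... | inj₁ w∈∁C = contradiction (Y⊆C w∈Y) (x∈∁p⇒x∉p w∈∁C)
    ... | inj₂ w∈⁅v⁆ = contradiction (subst (_∈ Y) (x∈⁅y⁆⇒x≡y v w∈⁅v⁆) w∈Y) v∉Y

  -- If T contains no edge, ∁ T contains a minimal transversal that T misses.
  minTransversal-dual⇒edge : ∀ {T} → IsMinTransversal (dual H) T → Edge H T
  minTransversal-dual⇒edge {T} (transT , minT)
    with anySubset? (λ C → edge? C ×-dec C ⊆? T)
  ... | yes (C , edgeC , C⊆T) =
    subst (Edge H) (⊆-antisym C⊆T (minT C C⊆T (edge-transversal-dual H edgeC))) edgeC
  ... | no ∄C with minimal-⊆ (transversal? H edge?) (∁ T) (∁-transversal H ∄C)
  ... | X , X⊆∁T , minX =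
    let (w , w∈T , w∈X) = transT X minX in contradiction w∈T (x∈∁p⇒x∉p (X⊆∁T w∈X))

  dual-involutive : dual (dual H) ≅H H
  dual-involutive E = mk⇔ minTransversal-dual⇒edge sperner-edge⇒minTransversal-dual

PairwiseCovered : Hypergraph m → Pred (Subset m) _
PairwiseCovered K U = ∀ u v → u ∈ U → v ∈ U → u ≢ v → ∃ λ E → Edge K E × u ∈ E × v ∈ E

conformal-resp-≅H : {K L : Hypergraph m} → K ≅H L → IsConformal K → IsConformal L
conformal-resp-≅H K≅L conformalK U coveredU =
  let (E , edgeE , U⊆E) = conformalK U covered in E , to (K≅L E) edgeE , U⊆E
  where
  covered : PairwiseCovered _ U
  covered u v u∈U v∈U u≢v =
    let (E , edgeE , u∈E , v∈E) = coveredU u v u∈U v∈U u≢v in E , from (K≅L E) edgeE , u∈E , v∈E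

coOcc-resp-≅H : {K L : Hypergraph m} {u v : Fin m} → K ≅H L → CoOcc K u v → CoOcc L u v
coOcc-resp-≅H K≅L (u≢v , E , edgeE , u∈E , v∈E) = u≢v , E , to (K≅L E) edgeE , u∈E , v∈E

module _ (G : Graph) where

  -- IsCliqueTransversal G is definitionally IsTransversal cliqueHypergraph,
  -- so minCTHypergraph G is dual cliqueHypergraph.
  cliqueHypergraph : Hypergraph (suc (n G))
  cliqueHypergraph = record { Edge = IsMaximalClique G }

  clique? : Decidable (IsClique G)
  clique? C = all? λ u → all? λ v → u ∈? C →-dec v ∈? C →-dec ¬? (u ≟ v) →-dec adj? G u v

  cliqueHypergraph-edge? : Decidable (Edge cliqueHypergraph)
  cliqueHypergraph-edge? = maximal? clique?

  cliqueHypergraph-sperner : IsSperner cliqueHypergraph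
  cliqueHypergraph-sperner {E = E} maxD maxE D⊆E = proj₂ maxD E (proj₁ maxE) D⊆E

  adj⇒pair-clique : {u v : V G} → Adj G u v → IsClique G (⁅ u ⁆ ∪ ⁅ v ⁆)
  adj⇒pair-clique uv x y x∈ y∈ x≢y with ∈-pair x∈ | ∈-pair y∈
  ... | inj₁ refl | inj₁ refl = contradiction refl x≢y
  ... | inj₁ refl | inj₂ refl = uv
  ... | inj₂ refl | inj₁ refl = sym G uv
  ... | inj₂ refl | inj₂ refl = contradiction refl x≢y

  clique⊆maximalClique : ∀ {C} → IsClique G C → ∃ λ D → C ⊆ D × IsMaximalClique G D
  clique⊆maximalClique = maximal-⊇ clique? _

  cliqueHypergraph-conformal : IsConformal cliqueHypergraph
  cliqueHypergraph-conformal U coveredU =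
    let (C , U⊆C , maxC) = clique⊆maximalClique cliqueU in C , maxC , U⊆C
    where
    cliqueU : IsClique G U
    cliqueU u v u∈U v∈U u≢v =
      let (E , (cliqueE , _) , u∈E , v∈E) = coveredU u v u∈U v∈U u≢v in cliqueE u v u∈E v∈E u≢v

  cliqueHypergraph-coOcc : IsCoOccGraphOf G cliqueHypergraph
  cliqueHypergraph-coOcc u v = mk⇔ adj⇒coOcc coOcc⇒adj
    where
    adj⇒coOcc : Adj G u v → CoOcc cliqueHypergraph u v
    adj⇒coOcc uv =
      let (C , pair⊆C , maxC) = clique⊆maximalClique (adj⇒pair-clique uv)
      in (λ { refl → irrefl G uv }) , C , maxC ,
         pair⊆C (x∈p∪q⁺ (inj₁ (x∈⁅x⁆ u))) , pair⊆C (x∈p∪q⁺ (inj₂ (x∈⁅x⁆ v)))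
    coOcc⇒adj : CoOcc cliqueHypergraph u v → Adj G u v
    coOcc⇒adj (u≢v , C , (cliqueC , _) , u∈C , v∈C) = cliqueC u v u∈C v∈C u≢v

  module _ {K : Hypergraph (suc (n G))} (coOccK : IsCoOccGraphOf G K) where

    edge⇒clique : ∀ {E} → Edge K E → IsClique G E
    edge⇒clique {E} edgeE u v u∈E v∈E u≢v = from (coOccK u v) (u≢v , E , edgeE , u∈E , v∈E)

    clique⇒pairwiseCovered : ∀ {U} → IsClique G U → PairwiseCovered K U
    clique⇒pairwiseCovered cliqueU u v u∈U v∈U u≢v =
      proj₂ (to (coOccK u v) (cliqueU u v u∈U v∈U u≢v))

    sperner-conformal⇒≅cliqueHypergraph : IsSperner K → IsConformal K → K ≅H cliqueHypergraph
    sperner-conformal⇒≅cliqueHypergraph sperner conformal T = mk⇔ edge⇒maximal maximal⇒edge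
      where
      edge⇒maximal : Edge K T → IsMaximalClique G T
      edge⇒maximal edgeT = edge⇒clique edgeT , λ D cliqueD T⊆D →
        let (E , edgeE , D⊆E) = conformal D (clique⇒pairwiseCovered cliqueD)
        in ⊆-trans D⊆E (sperner edgeT edgeE (⊆-trans T⊆D D⊆E))
      maximal⇒edge : IsMaximalClique G T → Edge K T
      maximal⇒edge (cliqueT , maxT) =
        let (E , edgeE , T⊆E) = conformal T (clique⇒pairwiseCovered cliqueT)
        in subst (Edge K) (⊆-antisym (maxT E (edge⇒clique edgeE) T⊆E) T⊆E) edgeE

  conformal×coOcc⇔≅cliqueHypergraph : {K : Hypergraph (suc (n G))} → IsSperner K →
    (IsConformal K × IsCoOccGraphOf G K) ⇔ K ≅H cliqueHypergraph
  conformal×coOcc⇔≅cliqueHypergraph sperner = mk⇔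
    (λ (conformal , coOcc) → sperner-conformal⇒≅cliqueHypergraph coOcc sperner conformal)
    (λ K≅C → conformal-resp-≅H (≅H-sym K≅C) cliqueHypergraph-conformal ,
             λ u v → ⇔.trans (cliqueHypergraph-coOcc u v)
                       (mk⇔ (coOcc-resp-≅H (≅H-sym K≅C)) (coOcc-resp-≅H K≅C)))

module _ (G : Graph) (k : ℕ) where

  private
    H = smallMinCTHypergraph G k

  smallMinCT-edge? : Decidable (Edge H)
  smallMinCT-edge? E = dual-edge? (cliqueHypergraph G) (cliqueHypergraph-edge? G) E ×-dec ∣ E ∣ ≤? k

  smallMinCT-sperner : IsSperner H
  smallMinCT-sperner (minD , _) (minE , _) = dual-sperner (cliqueHypergraph G) minD minE

  τc⁺≤⇔smallMinCT≅minCT : τc⁺≤ G k ⇔ (H ≅H minCTHypergraph G)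
  τc⁺≤⇔smallMinCT≅minCT = mk⇔
    (λ τ≤k X → mk⇔ proj₁ (λ minX → minX , τ≤k X minX))
    (λ H≅minCT X minX → proj₂ (from (H≅minCT X) minX))

  smallMinCT≅minCT⇔dual≅cliqueHypergraph :
    (H ≅H minCTHypergraph G) ⇔ (dual H ≅H cliqueHypergraph G)
  smallMinCT≅minCT⇔dual≅cliqueHypergraph = mk⇔
    (λ H≅minCT → ≅H-trans (dual-resp-≅H H≅minCT)
                   (dual-involutive (cliqueHypergraph G) (cliqueHypergraph-edge? G)
                                    (cliqueHypergraph-sperner G)))
    (λ dualH≅C → ≅H-trans (≅H-sym (dual-involutive H smallMinCT-edge? smallMinCT-sperner))
                   (dual-resp-≅H dualH≅C))

lemma4p6 : (k : ℕ) → 1 ≤ k → (G : Graph) →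
    let H = smallMinCTHypergraph G k in
    (τc⁺≤ G k ⇔ (H ≅H minCTHypergraph G))
    × ((H ≅H minCTHypergraph G) ⇔ (IsConformal (dual H) × IsCoOccGraphOf G (dual H)))
lemma4p6 k _ G =
  τc⁺≤⇔smallMinCT≅minCT G k ,
  ⇔.trans (smallMinCT≅minCT⇔dual≅cliqueHypergraph G k)
          (⇔.sym (conformal×coOcc⇔≅cliqueHypergraph G (dual-sperner (smallMinCTHypergraph G k))))
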